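{- Let $n,k\geqslant 0$ be integers with $n+k>0$, and let \[ \mathsf{d}'_{n,k}=(1-q^2z)(1-q^4z)\cdots(1-q^{2n}z)\,(1-z/q^2)(1-z/q^4)\cdots(1-z/q^{2k}). \] Then there exist non-zero polynomials $p_{n,k,i}\in\mathbb{Z}[z,q,q^{ -1}]$ for $1\leqslant i\leqslant n$ and $r_{n,k,i}\in\mathbb{Z}[z,q,q^{ -1}]$ for $1\leqslant i\leqslant k$ such that \[ \sum_{i=1}^{n}p_{n,k,i}\frac{\mathsf{d}'_{n,k}}{1-q^{2i}z}+\sum_{i=1}^{k}r_{n,k,i}\frac{\mathsf{d}'_{n,k}}{1-z/q^{2i}}=(1-z)(1-z^2)\cdots(1-z^{n+k}). \] -}

module Defs where

open import Data.Nat as ℕ using (ℕ; zero; suc)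
open import Data.Integer as ℤ using (ℤ; +_; -_)
open import Data.Fin using (Fin; toℕ)
open import Data.List using (List; []; _∷_; _++_; map; concatMap; foldr; upTo; allFin; filter)
open import Data.Product using (_×_; _,_; Σ; ∃)
open import Relation.Binary.PropositionalEquality using (_≡_; _≢_)
open import Relation.Nullary using (¬_; Dec; yes; no)
open import Relation.Nullary.Decidable using (⌊_⌋)
open import Data.Bool using (Bool; true; false; _∧_; if_then_else_)

-- Elements of ℤ[z,q,q⁻¹], represented as finite formal sums of monomials
-- c · z^a · q^b  (c : ℤ, a : ℕ, b : ℤ).  Two representations denote the same
-- Laurent polynomial iff all their coefficients agree (see _≈_ below).
Mono : Set
Mono = ℤ × ℕ × ℤ

Poly : Set
Poly = List Mono

coeff : Poly → ℕ → ℤ → ℤ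
coeff [] a b = + 0
coeff ((c , a' , b') ∷ p) a b =
  (if ⌊ a' ℕ.≟ a ⌋ ∧ ⌊ b' ℤ.≟ b ⌋ then c else + 0) ℤ.+ coeff p a b

_≈_ : Poly → Poly → Set
p ≈ r = ∀ a b → coeff p a b ≡ coeff r a b
infix 4 _≈_

NonZeroPoly : Poly → Set
NonZeroPoly p = ¬ (∀ a b → coeff p a b ≡ + 0)

0ₚ : Poly
0ₚ = []

1ₚ : Poly
1ₚ = (+ 1 , 0 , + 0) ∷ []

_+ₚ_ : Poly → Poly → Poly
p +ₚ r = p ++ r
infixl 6 _+ₚ_

mulMono : Mono → Mono → Mono
mulMono (c , a , b) (c' , a' , b') = (c ℤ.* c' , a ℕ.+ a' , b ℤ.+ b')

_*ₚ_ : Poly → Poly → Poly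
p *ₚ r = concatMap (λ m → map (mulMono m) r) p
infixl 7 _*ₚ_

sumₚ : List Poly → Poly
sumₚ = foldr _+ₚ_ 0ₚ

prodₚ : List Poly → Poly
prodₚ = foldr _*ₚ_ 1ₚ

oneTo : ℕ → List ℕ
oneTo m = map suc (upTo m)

facN : ℕ → Poly
facN j = (+ 1 , 0 , + 0) ∷ (- + 1 , 1 , + (2 ℕ.* j)) ∷ []

facK : ℕ → Poly
facK j = (+ 1 , 0 , + 0) ∷ (- + 1 , 1 , - + (2 ℕ.* j)) ∷ []

facZ : ℕ → Poly
facZ m = (+ 1 , 0 , + 0) ∷ (- + 1 , m , + 0) ∷ []

d' : ℕ → ℕ → Poly
d' n k = prodₚ (map facN (oneTo n)) *ₚ prodₚ (map facK (oneTo k))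

d'/facN : ℕ → ℕ → ℕ → Poly
d'/facN n k i =
  prodₚ (map facN (filter (λ j → Data.Bool.T? (Data.Bool.not ⌊ j ℕ.≟ i ⌋)) (oneTo n)))
    *ₚ prodₚ (map facK (oneTo k))
  where import Data.Bool

d'/facK : ℕ → ℕ → ℕ → Poly
d'/facK n k i =
  prodₚ (map facN (oneTo n))
    *ₚ prodₚ (map facK (filter (λ j → Data.Bool.T? (Data.Bool.not ⌊ j ℕ.≟ i ⌋)) (oneTo k)))
  where import Data.Bool

zProd : ℕ → Poly
zProd m = prodₚ (map facZ (oneTo m))

{-# OPTIONS --safe #-}

-- Write Q = q² and e_j = 1 - Q^j z, so that d′_{n,k} is the product of the e_j over the exponent set
-- S = {-k, …, -1, 1, …, n}; the claim is that ∏_{1 ≤ m ≤ |S|} (1 - z^m) lies in the ideal generated by the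
-- cofactors d′/e_j, with non-zero coefficients. We prove this for every exponent set S of the form
-- {u, …, u+|S|} minus one point, by induction on |S|. Pick a, b ∈ S such that S∖{a} and S∖{b} again have
-- this form (the two end points, or the first two points when the gap is at an end). By induction the
-- product P for |S|-1 lies in the cofactor ideals of both, and e_a·I(S∖{a}) ⊆ I(S); so P·(1 - z^{|S|})
-- lies in I(S) as soon as 1 - z^{|S|} ∈ ⟨e_a, e_b⟩. That holds because modulo ⟨e_a, e_b⟩ we have
-- zQ^a = zQ^b = 1, hence Q^{b-a} = 1, and (b - a) divides a·|S| for these choices. Finally every coefficient
-- c_j is made non-zero by adding w_j z^K e_j, with K above all z-degrees and non-zero weights w_j summing
-- to 0: this adds (∑ w_j) z^K d′ = 0 to the sum.

module Submission where

open import Algebra.Bundles using (CommutativeRing)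
open import Data.Bool using (if_then_else_)
open import Data.List using (List; []; _∷_; _++_; map; foldr; filter)
import Data.List.Properties as Listₚ
open import Data.List.Relation.Binary.Permutation.Propositional as ↭ using (_↭_; ↭⇒↭ₛ′)
import Data.List.Relation.Binary.Permutation.Setoid.Properties as Permₚ
open import Data.List.Relation.Unary.All as All using (All; []; _∷_)
open import Data.List.Relation.Unary.AllPairs using ([]; _∷_)
open import Data.List.Relation.Unary.Unique.Propositional using (Unique)
open import Data.Maybe using (nothing)
open import Data.Product using (∃; ∃₂; _×_; _,_)
open import Function using (_∘_)
open import Level using (_⊔_)
open import Relation.Binary.Definitions using (DecidableEquality)
import Relation.Binary.PropositionalEquality as ≡
open ≡ using (_≡_; _≢_; ≢-sym)
open import Relation.Nullary using (¬?)
open import Relation.Nullary.Decidable using (does; dec-true; dec-false)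

module CofactorIdeals {c ℓ} (R : CommutativeRing c ℓ) where

  open CommutativeRing R
  open import Algebra.Properties.AbelianGroup +-abelianGroup using (⁻¹-anti-homo‿-)
  open import Algebra.Properties.CommutativeSemigroup *-commutativeSemigroup using (x∙yz≈y∙xz)
  open import Algebra.Properties.Ring ring using (-1*x≈-x; x[y-z]≈xy-xz)
  open import Relation.Binary.Reasoning.Setoid setoid
  open import Tactic.RingSolver.Core.AlmostCommutativeRing using (fromCommutativeRing)
  open import Tactic.RingSolver.NonReflective (fromCommutativeRing R (λ _ → nothing))
    using (solve; _⊜_; _⊕_; _⊗_)

  ∏ : List Carrier → Carrier
  ∏ = foldr _*_ 1#

  ∑ : List Carrier → Carrier
  ∑ = foldr _+_ 0#

  ∏-++ : ∀ fs gs → ∏ (fs ++ gs) ≈ ∏ fs * ∏ gs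
  ∏-++ []       gs = sym (*-identityˡ (∏ gs))
  ∏-++ (f ∷ fs) gs = trans (*-congˡ (∏-++ fs gs)) (sym (*-assoc f (∏ fs) (∏ gs)))

  ∑-++ : ∀ xs ys → ∑ (xs ++ ys) ≈ ∑ xs + ∑ ys
  ∑-++ []       ys = sym (+-identityˡ (∑ ys))
  ∑-++ (x ∷ xs) ys = trans (+-congˡ (∑-++ xs ys)) (sym (+-assoc x (∑ xs) (∑ ys)))

  ∏-↭ : ∀ {fs gs} → fs ↭ gs → ∏ fs ≈ ∏ gs
  ∏-↭ p = Permₚ.foldr-commMonoid setoid *-isCommutativeMonoid (↭⇒↭ₛ′ isEquivalence p)

  ∑-cong : ∀ {a} {A : Set a} {u v : A → Carrier} {xs} → All (λ x → u x ≈ v x) xs →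
    ∑ (map u xs) ≈ ∑ (map v xs)
  ∑-cong []       = refl
  ∑-cong (e ∷ es) = +-cong e (∑-cong es)

  ∑-+ : ∀ {a} {A : Set a} (u v : A → Carrier) xs →
    ∑ (map (λ x → u x + v x) xs) ≈ ∑ (map u xs) + ∑ (map v xs)
  ∑-+ u v []       = sym (+-identityˡ 0#)
  ∑-+ u v (x ∷ xs) = trans (+-congˡ (∑-+ u v xs))
    (solve 4 (λ a b c d → (a ⊕ b ⊕ (c ⊕ d)) ⊜ (a ⊕ c ⊕ (b ⊕ d))) refl (u x) (v x) _ _)

  ∑-*ˡ : ∀ {a} {A : Set a} s (u : A → Carrier) xs → ∑ (map (λ x → s * u x) xs) ≈ s * ∑ (map u xs)
  ∑-*ˡ s u []       = sym (zeroʳ s)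
  ∑-*ˡ s u (x ∷ xs) = trans (+-congˡ (∑-*ˡ s u xs)) (sym (distribˡ s (u x) _))

  ∑-*ʳ : ∀ {a} {A : Set a} s (u : A → Carrier) xs → ∑ (map (λ x → u x * s) xs) ≈ ∑ (map u xs) * s
  ∑-*ʳ s u []       = sym (zeroˡ s)
  ∑-*ʳ s u (x ∷ xs) = trans (+-congˡ (∑-*ʳ s u xs)) (sym (distribʳ s (u x) _))

  -- The ideal generated by the cofactors ∏_{j ≠ i} f_j of a list fs, described recursively:
  -- splitting off the first factor f, its elements are f·Q + a·∏ fs′ with Q in the ideal of fs′.
  data InCofactorIdeal : List Carrier → Carrier → Set (c ⊔ ℓ) where
    nil  : ∀ {P} → P ≈ 0# → InCofactorIdeal [] P
    cons : ∀ {f fs P} Q a → InCofactorIdeal fs Q → P ≈ f * Q + a * ∏ fs → InCofactorIdeal (f ∷ fs) P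

  InCofactorIdeal-resp : ∀ {fs P P′} → P ≈ P′ → InCofactorIdeal fs P → InCofactorIdeal fs P′
  InCofactorIdeal-resp e (nil P≈0)        = nil (trans (sym e) P≈0)
  InCofactorIdeal-resp e (cons Q a m P≈)  = cons Q a m (trans (sym e) P≈)

  InCofactorIdeal-+ : ∀ {fs P P′} → InCofactorIdeal fs P → InCofactorIdeal fs P′ →
    InCofactorIdeal fs (P + P′)
  InCofactorIdeal-+ (nil P≈0) (nil P′≈0) = nil (trans (+-cong P≈0 P′≈0) (+-identityˡ 0#))
  InCofactorIdeal-+ {f ∷ fs} {P} {P′} (cons Q a m P≈) (cons Q′ a′ m′ P′≈) =
    cons (Q + Q′) (a + a′) (InCofactorIdeal-+ m m′) (begin
      P + P′                                     ≈⟨ +-cong P≈ P′≈ ⟩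
      (f * Q + a * ∏ fs) + (f * Q′ + a′ * ∏ fs) ≈⟨ solve 6 (λ f Q Q′ a a′ π →
          ((f ⊗ Q ⊕ a ⊗ π) ⊕ (f ⊗ Q′ ⊕ a′ ⊗ π)) ⊜ (f ⊗ (Q ⊕ Q′) ⊕ (a ⊕ a′) ⊗ π))
          refl f Q Q′ a a′ (∏ fs) ⟩
      f * (Q + Q′) + (a + a′) * ∏ fs             ∎)

  InCofactorIdeal-*ˡ : ∀ {fs P} s → InCofactorIdeal fs P → InCofactorIdeal fs (s * P)
  InCofactorIdeal-*ˡ s (nil P≈0) = nil (trans (*-congˡ P≈0) (zeroʳ s))
  InCofactorIdeal-*ˡ {f ∷ fs} {P} s (cons Q a m P≈) =
    cons (s * Q) (s * a) (InCofactorIdeal-*ˡ s m) (begin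
      s * P                        ≈⟨ *-congˡ P≈ ⟩
      s * (f * Q + a * ∏ fs)       ≈⟨ distribˡ s (f * Q) (a * ∏ fs) ⟩
      s * (f * Q) + s * (a * ∏ fs) ≈⟨ +-cong (x∙yz≈y∙xz s f Q) (sym (*-assoc s a (∏ fs))) ⟩
      f * (s * Q) + (s * a) * ∏ fs ∎)

  InCofactorIdeal-∷ : ∀ f {fs Q} → InCofactorIdeal fs Q → InCofactorIdeal (f ∷ fs) (f * Q)
  InCofactorIdeal-∷ f {fs} {Q} m = cons Q 0# m (begin
    f * Q             ≈⟨ +-identityʳ (f * Q) ⟨
    f * Q + 0#        ≈⟨ +-congˡ (zeroˡ (∏ fs)) ⟨
    f * Q + 0# * ∏ fs ∎)

  InCofactorIdeal-[_] : ∀ f P → InCofactorIdeal (f ∷ []) P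
  InCofactorIdeal-[ f ] P = cons 0# P (nil refl) (begin
    P               ≈⟨ *-identityʳ P ⟨
    P * 1#          ≈⟨ +-identityˡ (P * 1#) ⟨
    0# + P * 1#     ≈⟨ +-congʳ (zeroʳ f) ⟨
    f * 0# + P * 1# ∎)

  InCofactorIdeal-swap : ∀ {f g fs P} → InCofactorIdeal (f ∷ g ∷ fs) P →
    InCofactorIdeal (g ∷ f ∷ fs) P
  InCofactorIdeal-swap {f} {g} {fs} {P} (cons Q a (cons Q′ a′ m Q≈) P≈) =
    cons (f * Q′ + a * ∏ fs) a′ (cons Q′ a m refl) (begin
      P                                         ≈⟨ P≈ ⟩
      f * Q + a * (g * ∏ fs)                    ≈⟨ +-congʳ (*-congˡ Q≈) ⟩
      f * (g * Q′ + a′ * ∏ fs) + a * (g * ∏ fs) ≈⟨ solve 6 (λ f g Q′ a a′ π →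
          (f ⊗ (g ⊗ Q′ ⊕ a′ ⊗ π) ⊕ a ⊗ (g ⊗ π)) ⊜ (g ⊗ (f ⊗ Q′ ⊕ a ⊗ π) ⊕ a′ ⊗ (f ⊗ π)))
          refl f g Q′ a a′ (∏ fs) ⟩
      g * (f * Q′ + a * ∏ fs) + a′ * (f * ∏ fs) ∎)

  InCofactorIdeal-∷⁺ : ∀ {f fs gs P} → (∀ {Q} → InCofactorIdeal fs Q → InCofactorIdeal gs Q) →
    ∏ fs ≈ ∏ gs → InCofactorIdeal (f ∷ fs) P → InCofactorIdeal (f ∷ gs) P
  InCofactorIdeal-∷⁺ fs⇒gs ∏≈∏ (cons Q a m P≈) =
    cons Q a (fs⇒gs m) (trans P≈ (+-congˡ (*-congˡ ∏≈∏)))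

  InCofactorIdeal-↭ : ∀ {fs gs P} → fs ↭ gs → InCofactorIdeal fs P → InCofactorIdeal gs P
  InCofactorIdeal-↭ ↭.refl         m = m
  InCofactorIdeal-↭ (↭.prep f p)   m = InCofactorIdeal-∷⁺ (InCofactorIdeal-↭ p) (∏-↭ p) m
  InCofactorIdeal-↭ (↭.swap f g p) m =
    InCofactorIdeal-∷⁺ (InCofactorIdeal-∷⁺ (InCofactorIdeal-↭ p) (∏-↭ p)) (*-congˡ (∏-↭ p))
      (InCofactorIdeal-swap m)
  InCofactorIdeal-↭ (↭.trans p q)  m = InCofactorIdeal-↭ q (InCofactorIdeal-↭ p m)

  _∈⟨_,_⟩ : Carrier → Carrier → Carrier → Set (c ⊔ ℓ)
  x ∈⟨ g₁ , g₂ ⟩ = ∃₂ λ A B → x ≈ A * g₁ + B * g₂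

  record _≡_mod⟨_,_⟩ (x y g₁ g₂ : Carrier) : Set (c ⊔ ℓ) where
    constructor difference
    field x-y∈⟨⟩ : x - y ∈⟨ g₁ , g₂ ⟩
  open _≡_mod⟨_,_⟩ public

  infix 4 _∈⟨_,_⟩ _≡_mod⟨_,_⟩

  module _ {g₁ g₂ : Carrier} where

    ∈⟨⟩-resp : ∀ {x y} → x ≈ y → x ∈⟨ g₁ , g₂ ⟩ → y ∈⟨ g₁ , g₂ ⟩
    ∈⟨⟩-resp x≈y (A , B , x≈) = A , B , trans (sym x≈y) x≈

    ∈⟨⟩-gen₁ : g₁ ∈⟨ g₁ , g₂ ⟩
    ∈⟨⟩-gen₁ = 1# , 0# , sym (trans (+-cong (*-identityˡ g₁) (zeroˡ g₂)) (+-identityʳ g₁))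

    ∈⟨⟩-gen₂ : g₂ ∈⟨ g₁ , g₂ ⟩
    ∈⟨⟩-gen₂ = 0# , 1# , sym (trans (+-cong (zeroˡ g₁) (*-identityˡ g₂)) (+-identityˡ g₂))

    ∈⟨⟩-0# : 0# ∈⟨ g₁ , g₂ ⟩
    ∈⟨⟩-0# = 0# , 0# , sym (trans (+-cong (zeroˡ g₁) (zeroˡ g₂)) (+-identityˡ 0#))

    ∈⟨⟩-+ : ∀ {x y} → x ∈⟨ g₁ , g₂ ⟩ → y ∈⟨ g₁ , g₂ ⟩ → x + y ∈⟨ g₁ , g₂ ⟩
    ∈⟨⟩-+ {x} {y} (A , B , x≈) (A′ , B′ , y≈) = A + A′ , B + B′ , (begin
      x + y                                   ≈⟨ +-cong x≈ y≈ ⟩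
      (A * g₁ + B * g₂) + (A′ * g₁ + B′ * g₂) ≈⟨ solve 6 (λ A B A′ B′ g₁ g₂ →
        ((A ⊗ g₁ ⊕ B ⊗ g₂) ⊕ (A′ ⊗ g₁ ⊕ B′ ⊗ g₂)) ⊜ ((A ⊕ A′) ⊗ g₁ ⊕ (B ⊕ B′) ⊗ g₂))
        refl A B A′ B′ g₁ g₂ ⟩
      (A + A′) * g₁ + (B + B′) * g₂           ∎)

    ∈⟨⟩-*ˡ : ∀ s {x} → x ∈⟨ g₁ , g₂ ⟩ → s * x ∈⟨ g₁ , g₂ ⟩
    ∈⟨⟩-*ˡ s {x} (A , B , x≈) = s * A , s * B , (begin
      s * x                       ≈⟨ *-congˡ x≈ ⟩
      s * (A * g₁ + B * g₂)       ≈⟨ distribˡ s (A * g₁) (B * g₂) ⟩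
      s * (A * g₁) + s * (B * g₂) ≈⟨ +-cong (*-assoc s A g₁) (*-assoc s B g₂) ⟨
      (s * A) * g₁ + (s * B) * g₂ ∎)

    ≈⇒≡mod : ∀ {x y} → x ≈ y → x ≡ y mod⟨ g₁ , g₂ ⟩
    ≈⇒≡mod {x} {y} x≈y =
      difference (∈⟨⟩-resp (sym (trans (+-congʳ x≈y) (-‿inverseʳ y))) ∈⟨⟩-0#)

    ≡mod-sym : ∀ {x y} → x ≡ y mod⟨ g₁ , g₂ ⟩ → y ≡ x mod⟨ g₁ , g₂ ⟩
    ≡mod-sym {x} {y} (difference x-y∈) =
      difference (∈⟨⟩-resp (trans (-1*x≈-x (x - y)) (⁻¹-anti-homo‿- x y)) (∈⟨⟩-*ˡ (- 1#) x-y∈))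

    ≡mod-trans : ∀ {x y z} → x ≡ y mod⟨ g₁ , g₂ ⟩ → y ≡ z mod⟨ g₁ , g₂ ⟩ →
      x ≡ z mod⟨ g₁ , g₂ ⟩
    ≡mod-trans {x} {y} {z} (difference x-y∈) (difference y-z∈) = difference (∈⟨⟩-resp (begin
      (x - y) + (y - z)   ≈⟨ +-assoc x (- y) (y - z) ⟩
      x + (- y + (y - z)) ≈⟨ +-congˡ (+-assoc (- y) y (- z)) ⟨
      x + ((- y + y) - z) ≈⟨ +-congˡ (+-congʳ (-‿inverseˡ y)) ⟩
      x + (0# - z)        ≈⟨ +-congˡ (+-identityˡ (- z)) ⟩
      x - z               ∎) (∈⟨⟩-+ x-y∈ y-z∈))

    ≡mod-*ˡ : ∀ s {x y} → x ≡ y mod⟨ g₁ , g₂ ⟩ → s * x ≡ s * y mod⟨ g₁ , g₂ ⟩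
    ≡mod-*ˡ s {x} {y} (difference x-y∈) =
      difference (∈⟨⟩-resp (x[y-z]≈xy-xz s x y) (∈⟨⟩-*ˡ s x-y∈))

    ≡mod-* : ∀ {x x′ y y′} → x ≡ y mod⟨ g₁ , g₂ ⟩ → x′ ≡ y′ mod⟨ g₁ , g₂ ⟩ →
      x * x′ ≡ y * y′ mod⟨ g₁ , g₂ ⟩
    ≡mod-* {x} {x′} {y} {y′} x≡y x′≡y′ = ≡mod-trans (≡mod-*ˡ x x′≡y′)
      (≡mod-trans (≈⇒≡mod (*-comm x y′)) (≡mod-trans (≡mod-*ˡ y′ x≡y) (≈⇒≡mod (*-comm y′ y))))

  InCofactorIdeal-merge : ∀ {f g fs Q h} → InCofactorIdeal (f ∷ fs) Q → InCofactorIdeal (g ∷ fs) Q →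
    h ∈⟨ f , g ⟩ → InCofactorIdeal (f ∷ g ∷ fs) (Q * h)
  InCofactorIdeal-merge {f} {g} {fs} {Q} {h} mf mg (A , B , h≈) = InCofactorIdeal-resp (begin
    A * (f * Q) + B * (g * Q) ≈⟨ +-cong (*-assoc A f Q) (*-assoc B g Q) ⟨
    (A * f) * Q + (B * g) * Q ≈⟨ distribʳ Q (A * f) (B * g) ⟨
    (A * f + B * g) * Q       ≈⟨ *-congʳ h≈ ⟨
    h * Q                     ≈⟨ *-comm h Q ⟩
    Q * h                     ∎)
    (InCofactorIdeal-+ (InCofactorIdeal-*ˡ A (InCofactorIdeal-∷ f mg))
                       (InCofactorIdeal-*ˡ B (InCofactorIdeal-swap (InCofactorIdeal-∷ g mf))))

  module CofactorSums {x} {X : Set x} (_≟_ : DecidableEquality X) (f : X → Carrier) where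

    cofactor : List X → X → Carrier
    cofactor ks k = ∏ (map f (filter (λ j → ¬? (j ≟ k)) ks))

    cofactorSum : (X → Carrier) → List X → Carrier
    cofactorSum a ks = ∑ (map (λ k → a k * cofactor ks k) ks)

    cofactor-∷-self : ∀ {k ks} → All (k ≢_) ks → cofactor (k ∷ ks) k ≡ ∏ (map f ks)
    cofactor-∷-self {k} k∉ks = ≡.cong (∏ ∘ map f) (≡.trans
      (Listₚ.filter-reject (λ j → ¬? (j ≟ k)) (λ k≢k → k≢k ≡.refl))
      (Listₚ.filter-all (λ j → ¬? (j ≟ k)) (All.map ≢-sym k∉ks)))

    cofactor-∷-other : ∀ {k j ks} → k ≢ j → cofactor (k ∷ ks) j ≡ f k * cofactor ks j
    cofactor-∷-other {j = j} k≢j =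
      ≡.cong (∏ ∘ map f) (Listₚ.filter-accept (λ i → ¬? (i ≟ j)) k≢j)

    flatten : ∀ {ks P} → Unique ks → InCofactorIdeal (map f ks) P → ∃ λ a → P ≈ cofactorSum a ks
    flatten []                  (nil P≈0) = (λ _ → 0#) , P≈0
    flatten {k ∷ ks} {P} (k∉ks ∷ uniq) (cons Q a₀ m P≈) with flatten uniq m
    ... | a , Q≈ = a′ , (begin
      P                                                  ≈⟨ P≈ ⟩
      f k * Q + a₀ * ∏ (map f ks)                       ≈⟨ +-comm _ _ ⟩
      a₀ * ∏ (map f ks) + f k * Q
        ≈⟨ +-cong (*-congˡ (reflexive (≡.sym (cofactor-∷-self k∉ks)))) (*-congˡ Q≈) ⟩
      a₀ * cofactor (k ∷ ks) k + f k * cofactorSum a ks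
        ≈⟨ +-cong (*-congʳ (reflexive (≡.sym a′k≡a₀)))
                  (sym (∑-*ˡ (f k) (λ j → a j * cofactor ks j) ks)) ⟩
      a′ k * cofactor (k ∷ ks) k + ∑ (map (λ j → f k * (a j * cofactor ks j)) ks)
        ≈⟨ +-congˡ (∑-cong (All.map (λ {j} → other j) k∉ks)) ⟩
      cofactorSum a′ (k ∷ ks)                            ∎)
      where
      a′ : X → Carrier
      a′ j = if does (j ≟ k) then a₀ else a j
      a′k≡a₀ : a′ k ≡ a₀
      a′k≡a₀ = ≡.cong (if_then a₀ else a k) (dec-true (k ≟ k) ≡.refl)
      other : ∀ j → k ≢ j → f k * (a j * cofactor ks j) ≈ a′ j * cofactor (k ∷ ks) j
      other j k≢j = begin
        f k * (a j * cofactor ks j) ≈⟨ x∙yz≈y∙xz (f k) (a j) _ ⟩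
        a j * (f k * cofactor ks j)
          ≈⟨ *-cong (reflexive (≡.cong (if_then a₀ else a j) (dec-false (j ≟ k) (≢-sym k≢j))))
                    (reflexive (cofactor-∷-other k≢j)) ⟨
        a′ j * cofactor (k ∷ ks) j ∎

    f*cofactor≈∏ : ∀ {ks} → Unique ks → All (λ k → f k * cofactor ks k ≈ ∏ (map f ks)) ks
    f*cofactor≈∏ []                     = []
    f*cofactor≈∏ {k ∷ ks} (k∉ks ∷ uniq) =
      *-congˡ (reflexive (cofactor-∷-self k∉ks)) ∷ All.zipWith step (k∉ks , f*cofactor≈∏ uniq)
      where
      step : ∀ {j} → k ≢ j × f j * cofactor ks j ≈ ∏ (map f ks) →
             f j * cofactor (k ∷ ks) j ≈ ∏ (map f (k ∷ ks))
      step {j} (k≢j , fj*cofactor≈∏) = begin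
        f j * cofactor (k ∷ ks) j   ≈⟨ *-congˡ (reflexive (cofactor-∷-other k≢j)) ⟩
        f j * (f k * cofactor ks j) ≈⟨ x∙yz≈y∙xz (f j) (f k) _ ⟩
        f k * (f j * cofactor ks j) ≈⟨ *-congˡ fj*cofactor≈∏ ⟩
        f k * ∏ (map f ks)          ∎

    -- Since f k · cofactor ks k ≈ ∏ f for every key, the shift adds (∑ s) · ∏ f to the sum.
    cofactorSum-shift : ∀ {ks} a s → Unique ks → ∑ (map s ks) ≈ 0# →
      cofactorSum (λ k → a k + s k * f k) ks ≈ cofactorSum a ks
    cofactorSum-shift {ks} a s uniq ∑s≈0 = begin
      cofactorSum (λ k → a k + s k * f k) ks
        ≈⟨ ∑-cong (All.universal (λ k → distribʳ (cofactor ks k) (a k) (s k * f k)) ks) ⟩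
      ∑ (map (λ k → a k * cofactor ks k + (s k * f k) * cofactor ks k) ks)
        ≈⟨ ∑-+ (λ k → a k * cofactor ks k) (λ k → (s k * f k) * cofactor ks k) ks ⟩
      cofactorSum a ks + ∑ (map (λ k → (s k * f k) * cofactor ks k) ks)
        ≈⟨ +-congˡ (∑-cong (All.map (λ {k} e → trans (*-assoc (s k) (f k) _) (*-congˡ e))
                                    (f*cofactor≈∏ uniq))) ⟩
      cofactorSum a ks + ∑ (map (λ k → s k * ∏ (map f ks)) ks)
        ≈⟨ +-congˡ (∑-*ʳ (∏ (map f ks)) s ks) ⟩
      cofactorSum a ks + ∑ (map s ks) * ∏ (map f ks)
        ≈⟨ +-congˡ (trans (*-congʳ ∑s≈0) (zeroˡ _)) ⟩
      cofactorSum a ks + 0#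
        ≈⟨ +-identityʳ _ ⟩
      cofactorSum a ks ∎

-- Imported only after CofactorIdeals, in which `_+_`, `_≈_`, `refl`, … are the ring's.
open import Defs
open import Data.Nat using (ℕ; zero; suc; _+_; _<_)
open import Data.Fin using (Fin; toℕ)
open import Data.List using (map; allFin)
open import Data.Product using (Σ; _×_)

open import Algebra.Bundles using (AbelianGroup)
open import Data.Bool using (true; false; _∧_; not; T?)
open import Data.Empty using (⊥-elim)
import Data.Fin.Properties as Finₚ
open import Data.Integer as ℤ using (ℤ; +_; -[1+_])
import Data.Integer.Properties as ℤₚ
open import Data.Integer.Tactic.RingSolver using (solve-∀)
open import Data.List using (_∷ʳ_; [_]; concat; concatMap; length; upTo; applyUpTo; tabulate)
open import Data.List.Extrema.Nat using (max; xs≤max)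
open import Data.List.Membership.Propositional using (_∈_)
open import Data.List.Membership.Propositional.Properties
  using (∈-map⁺; ∈-map⁻; ∈-upTo⁺; ∈-++⁺ˡ; ∈-++⁺ʳ)
open import Data.List.Relation.Binary.Permutation.Propositional
  using (↭-prep; ↭-sym; ↭-trans; ↭-reflexive; module PermutationReasoning)
open import Data.List.Relation.Binary.Permutation.Propositional.Properties using (map⁺; ∷↭∷ʳ)
import Data.List.Relation.Unary.All.Properties as Allₚ
import Data.List.Relation.Unary.Unique.Propositional.Properties as Uniqueₚ
import Data.Nat as ℕ
import Data.Nat.Properties as ℕₚ
open import Data.Sum using (inj₁; inj₂)
open import Function using (id; case_of_)
open import Function.Bundles using (_⇔_; mk⇔)
open import Level using (0ℓ)
open import Relation.Binary.PropositionalEquality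
  using (refl; sym; trans; cong; cong₂; subst; module ≡-Reasoning)
import Relation.Binary.Reasoning.Setoid as SetoidReasoning
open import Relation.Nullary using (Dec; yes; no; ¬_)
open import Relation.Nullary.Decidable using (⌊_⌋; does-⇔; isYes≗does)

-- The ring ℤ[z,q,q⁻¹]

coeffₘ : Mono → ℕ → ℤ → ℤ
coeffₘ (c , a′ , b′) a b = if ⌊ a′ ℕ.≟ a ⌋ ∧ ⌊ b′ ℤ.≟ b ⌋ then c else + 0

-- `p ≈ r` unfolds to a Π-type, which unification cannot invert; the record makes it usable as the
-- equality of a setoid.
record _≋_ (p r : Poly) : Set where
  constructor coeffwise
  field coeff-≡ : p ≈ r
open _≋_
infix 4 _≋_

≋-refl : ∀ {p} → p ≋ p
≋-refl = coeffwise λ _ _ → refl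

≋-sym : ∀ {p r} → p ≋ r → r ≋ p
≋-sym (coeffwise e) = coeffwise λ a b → sym (e a b)

≋-trans : ∀ {p r s} → p ≋ r → r ≋ s → p ≋ s
≋-trans (coeffwise e) (coeffwise f) = coeffwise λ a b → trans (e a b) (f a b)

≋-reflexive : ∀ {p r} → p ≡ r → p ≋ r
≋-reflexive refl = ≋-refl

coeff-++ : ∀ p r a b → coeff (p ++ r) a b ≡ coeff p a b ℤ.+ coeff r a b
coeff-++ []      r a b = sym (ℤₚ.+-identityˡ _)
coeff-++ (m ∷ p) r a b =
  trans (cong (λ x → coeffₘ m a b ℤ.+ x) (coeff-++ p r a b)) (sym (ℤₚ.+-assoc (coeffₘ m a b) _ _))

negₘ : Mono → Mono
negₘ (c , a , b) = (ℤ.- c , a , b)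

-ₚ_ : Poly → Poly
-ₚ_ = map negₘ

coeffₘ-neg : ∀ m a b → coeffₘ (negₘ m) a b ≡ ℤ.- coeffₘ m a b
coeffₘ-neg (c , a′ , b′) a b with ⌊ a′ ℕ.≟ a ⌋ ∧ ⌊ b′ ℤ.≟ b ⌋
... | true  = refl
... | false = refl

coeff-neg : ∀ p a b → coeff (-ₚ p) a b ≡ ℤ.- coeff p a b
coeff-neg []      a b = refl
coeff-neg (m ∷ p) a b =
  trans (cong₂ ℤ._+_ (coeffₘ-neg m a b) (coeff-neg p a b)) (sym (ℤₚ.neg-distrib-+ (coeffₘ m a b) _))

+-cong : ∀ {p p′ r r′} → p ≋ p′ → r ≋ r′ → p ++ r ≋ p′ ++ r′
+-cong {p} {p′} {r} {r′} (coeffwise e) (coeffwise f) = coeffwise λ a b →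
  trans (coeff-++ p r a b) (trans (cong₂ ℤ._+_ (e a b) (f a b)) (sym (coeff-++ p′ r′ a b)))

+-comm : ∀ p r → p ++ r ≋ r ++ p
+-comm p r = coeffwise λ a b →
  trans (coeff-++ p r a b) (trans (ℤₚ.+-comm (coeff p a b) _) (sym (coeff-++ r p a b)))

+-assoc : ∀ p r s → (p ++ r) ++ s ≋ p ++ (r ++ s)
+-assoc p r s = ≋-reflexive (Listₚ.++-assoc p r s)

x+[y+z]≋y+[x+z] : ∀ p r s → p ++ (r ++ s) ≋ r ++ (p ++ s)
x+[y+z]≋y+[x+z] p r s =
  ≋-trans (≋-sym (+-assoc p r s)) (≋-trans (+-cong (+-comm p r) ≋-refl) (+-assoc r p s))

-‿cong : ∀ {p r} → p ≋ r → -ₚ p ≋ -ₚ r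
-‿cong {p} {r} (coeffwise e) = coeffwise λ a b →
  trans (coeff-neg p a b) (trans (cong ℤ.-_ (e a b)) (sym (coeff-neg r a b)))

-‿inverseʳ : ∀ p → p ++ -ₚ p ≋ []
-‿inverseʳ p = coeffwise λ a b → trans (coeff-++ p (-ₚ p) a b)
  (trans (cong (λ x → coeff p a b ℤ.+ x) (coeff-neg p a b)) (ℤₚ.+-inverseʳ (coeff p a b)))

mulMono-comm : ∀ m m′ → mulMono m m′ ≡ mulMono m′ m
mulMono-comm (c , a , b) (c′ , a′ , b′) =
  cong₂ _,_ (ℤₚ.*-comm c c′) (cong₂ _,_ (ℕₚ.+-comm a a′) (ℤₚ.+-comm b b′))

mulMono-assoc : ∀ m m′ m″ → mulMono (mulMono m m′) m″ ≡ mulMono m (mulMono m′ m″)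
mulMono-assoc (c , a , b) (c′ , a′ , b′) (c″ , a″ , b″) =
  cong₂ _,_ (ℤₚ.*-assoc c c′ c″) (cong₂ _,_ (ℕₚ.+-assoc a a′ a″) (ℤₚ.+-assoc b b′ b″))

mulMono-identityˡ : ∀ m → mulMono (+ 1 , 0 , + 0) m ≡ m
mulMono-identityˡ (c , a , b) = cong₂ _,_ (ℤₚ.*-identityˡ c) (cong (a ,_) (ℤₚ.+-identityˡ b))

⌊⌋-⇔ : ∀ {A B : Set} → A ⇔ B → (a? : Dec A) (b? : Dec B) → ⌊ a? ⌋ ≡ ⌊ b? ⌋
⌊⌋-⇔ A⇔B a? b? = trans (isYes≗does a?) (trans (does-⇔ A⇔B a? b?) (sym (isYes≗does b?)))

coeffₘ-shift : ∀ c a₀ b₀ m a b →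
  coeffₘ (mulMono (c , a₀ , b₀) m) (a₀ ℕ.+ a) (b₀ ℤ.+ b) ≡ c ℤ.* coeffₘ m a b
coeffₘ-shift c a₀ b₀ (c′ , a′ , b′) a b =
  trans (cong₂ (λ s t → if s ∧ t then c ℤ.* c′ else + 0)
    (⌊⌋-⇔ (mk⇔ (ℕₚ.+-cancelˡ-≡ a₀ a′ a) (cong (a₀ ℕ.+_))) (a₀ ℕ.+ a′ ℕ.≟ a₀ ℕ.+ a) (a′ ℕ.≟ a))
    (⌊⌋-⇔ (mk⇔ (ℤ+-cancelˡ b₀ b′ b) (cong (λ x → b₀ ℤ.+ x))) (b₀ ℤ.+ b′ ℤ.≟ b₀ ℤ.+ b) (b′ ℤ.≟ b)))
    (if-*ˡ (⌊ a′ ℕ.≟ a ⌋ ∧ ⌊ b′ ℤ.≟ b ⌋))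
  where
  open import Algebra.Properties.Group (AbelianGroup.group ℤₚ.+-0-abelianGroup)
    using () renaming (∙-cancelˡ to ℤ+-cancelˡ)
  if-*ˡ : ∀ t → (if t then c ℤ.* c′ else + 0) ≡ c ℤ.* (if t then c′ else + 0)
  if-*ˡ true  = refl
  if-*ˡ false = sym (ℤₚ.*-zeroʳ c)

coeffₘ-below : ∀ c a₀ b₀ m a b → a ℕ.< a₀ → coeffₘ (mulMono (c , a₀ , b₀) m) a b ≡ + 0
coeffₘ-below c a₀ b₀ (c′ , a′ , b′) a b a<a₀ with a₀ ℕ.+ a′ ℕ.≟ a
... | yes a₀+a′≡a = ⊥-elim (ℕₚ.<⇒≱ a<a₀ (subst (a₀ ℕ.≤_) a₀+a′≡a (ℕₚ.m≤m+n a₀ a′)))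
... | no _        = refl

coeff-shift : ∀ c a₀ b₀ r a b →
  coeff (map (mulMono (c , a₀ , b₀)) r) (a₀ ℕ.+ a) (b₀ ℤ.+ b) ≡ c ℤ.* coeff r a b
coeff-shift c a₀ b₀ []      a b = sym (ℤₚ.*-zeroʳ c)
coeff-shift c a₀ b₀ (m ∷ r) a b =
  trans (cong₂ ℤ._+_ (coeffₘ-shift c a₀ b₀ m a b) (coeff-shift c a₀ b₀ r a b))
        (sym (ℤₚ.*-distribˡ-+ c (coeffₘ m a b) _))

coeff-shift′ : ∀ c a₀ b₀ r a b →
  coeff (map (mulMono (c , a₀ , b₀)) r) (a₀ ℕ.+ a) b ≡ c ℤ.* coeff r a (ℤ.- b₀ ℤ.+ b)
coeff-shift′ c a₀ b₀ r a b =
  subst (λ b′ → coeff (map (mulMono (c , a₀ , b₀)) r) (a₀ ℕ.+ a) b′ ≡ c ℤ.* coeff r a (ℤ.- b₀ ℤ.+ b))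
    (i+[-i+j]≡j b₀ b) (coeff-shift c a₀ b₀ r a (ℤ.- b₀ ℤ.+ b))
  where
  i+[-i+j]≡j : ∀ i j → i ℤ.+ (ℤ.- i ℤ.+ j) ≡ j
  i+[-i+j]≡j = solve-∀

coeff-below : ∀ c a₀ b₀ r a b → a ℕ.< a₀ → coeff (map (mulMono (c , a₀ , b₀)) r) a b ≡ + 0
coeff-below c a₀ b₀ []      a b a<a₀ = refl
coeff-below c a₀ b₀ (m ∷ r) a b a<a₀ =
  cong₂ ℤ._+_ (coeffₘ-below c a₀ b₀ m a b a<a₀) (coeff-below c a₀ b₀ r a b a<a₀)

mulMono-congʳ : ∀ m {r r′} → r ≋ r′ → map (mulMono m) r ≋ map (mulMono m) r′
mulMono-congʳ (c , a₀ , b₀) {r} {r′} (coeffwise r≈r′) = coeffwise go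
  where
  go : ∀ a b →
    coeff (map (mulMono (c , a₀ , b₀)) r) a b ≡ coeff (map (mulMono (c , a₀ , b₀)) r′) a b
  go a b with ℕₚ.<-≤-connex a a₀
  ... | inj₁ a<a₀ = trans (coeff-below c a₀ b₀ r a b a<a₀) (sym (coeff-below c a₀ b₀ r′ a b a<a₀))
  ... | inj₂ a₀≤a with ℕₚ.m≤n⇒∃[o]m+o≡n a₀≤a
  ...   | d , refl = trans (coeff-shift′ c a₀ b₀ r d b)
                       (trans (cong (c ℤ.*_) (r≈r′ d _)) (sym (coeff-shift′ c a₀ b₀ r′ d b)))

*-congʳ : ∀ p {r r′} → r ≋ r′ → p *ₚ r ≋ p *ₚ r′
*-congʳ []      r≋r′ = ≋-refl
*-congʳ (m ∷ p) r≋r′ = +-cong (mulMono-congʳ m r≋r′) (*-congʳ p r≋r′)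

*-zeroʳ : ∀ p → p *ₚ [] ≡ []
*-zeroʳ []      = refl
*-zeroʳ (m ∷ p) = *-zeroʳ p

*-distribʳ : ∀ p r s → (r ++ s) *ₚ p ≋ r *ₚ p ++ s *ₚ p
*-distribʳ p r s = ≋-reflexive (Listₚ.concatMap-++ (λ m → map (mulMono m) p) r s)

*-identityˡ : ∀ p → 1ₚ *ₚ p ≋ p
*-identityˡ p = ≋-reflexive (trans (Listₚ.++-identityʳ _)
  (trans (Listₚ.map-cong mulMono-identityˡ p) (Listₚ.map-id p)))

*-∷ʳ : ∀ p m r → p *ₚ (m ∷ r) ≋ map (λ m′ → mulMono m′ m) p ++ p *ₚ r
*-∷ʳ []       m r = ≋-refl
*-∷ʳ (m′ ∷ p) m r = +-cong (≋-refl {mulMono m′ m ∷ []})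
  (≋-trans (+-cong (≋-refl {map (mulMono m′) r}) (*-∷ʳ p m r))
           (x+[y+z]≋y+[x+z] (map (mulMono m′) r) _ (p *ₚ r)))

*-comm : ∀ p r → p *ₚ r ≋ r *ₚ p
*-comm p []      = ≋-reflexive (*-zeroʳ p)
*-comm p (m ∷ r) = ≋-trans (*-∷ʳ p m r)
  (+-cong (≋-reflexive (Listₚ.map-cong (λ m′ → mulMono-comm m′ m) p)) (*-comm p r))

*-identityʳ : ∀ p → p *ₚ 1ₚ ≋ p
*-identityʳ p = ≋-trans (*-comm p 1ₚ) (*-identityˡ p)

mulMono-*ₚ : ∀ m r s → map (mulMono m) r *ₚ s ≡ map (mulMono m) (r *ₚ s)
mulMono-*ₚ m r s = begin
  concatMap (λ m″ → map (mulMono m″) s) (map (mulMono m) r)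
    ≡⟨ Listₚ.concatMap-map _ (mulMono m) r ⟩
  concatMap (λ m′ → map (mulMono (mulMono m m′)) s) r
    ≡⟨ cong concat (Listₚ.map-cong (λ m′ → trans (Listₚ.map-cong (mulMono-assoc m m′) s)
                                                   (Listₚ.map-∘ s)) r) ⟩
  concatMap (λ m′ → map (mulMono m) (map (mulMono m′) s)) r
    ≡⟨ Listₚ.map-concatMap (mulMono m) _ r ⟨
  map (mulMono m) (r *ₚ s) ∎
  where open ≡-Reasoning

*-assoc : ∀ p r s → (p *ₚ r) *ₚ s ≋ p *ₚ (r *ₚ s)
*-assoc []      r s = ≋-refl
*-assoc (m ∷ p) r s = ≋-trans (*-distribʳ s (map (mulMono m) r) (p *ₚ r))
  (+-cong (≋-reflexive (mulMono-*ₚ m r s)) (*-assoc p r s))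

*-cong : ∀ {p p′ r r′} → p ≋ p′ → r ≋ r′ → p *ₚ r ≋ p′ *ₚ r′
*-cong {p} {p′} {r} {r′} p≋p′ r≋r′ =
  ≋-trans (*-congʳ p r≋r′) (≋-trans (*-comm p r′) (≋-trans (*-congʳ r′ p≋p′) (*-comm r′ p′)))

*-distribˡ : ∀ p r s → p *ₚ (r ++ s) ≋ p *ₚ r ++ p *ₚ s
*-distribˡ p r s = ≋-trans (*-comm p (r ++ s))
  (≋-trans (*-distribʳ p r s) (+-cong (*-comm r p) (*-comm s p)))

ℤ[z,q,q⁻¹] : CommutativeRing 0ℓ 0ℓ
ℤ[z,q,q⁻¹] = record
  { Carrier = Poly ; _≈_ = _≋_ ; _+_ = _++_ ; _*_ = _*ₚ_ ; -_ = -ₚ_ ; 0# = [] ; 1# = 1ₚ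
  ; isCommutativeRing = record
    { isRing = record
      { +-isAbelianGroup = record
        { isGroup = record
          { isMonoid = record
            { isSemigroup = record
              { isMagma = record
                { isEquivalence = record { refl = ≋-refl ; sym = ≋-sym ; trans = ≋-trans }
                ; ∙-cong = +-cong }
              ; assoc = +-assoc }
            ; identity = (λ _ → ≋-refl) , λ p → ≋-reflexive (Listₚ.++-identityʳ p) }
          ; inverse = (λ p → ≋-trans (+-comm (-ₚ p) p) (-‿inverseʳ p)) , -‿inverseʳ
          ; ⁻¹-cong = -‿cong }
        ; comm = +-comm }
      ; *-cong = *-cong
      ; *-assoc = *-assoc
      ; *-identity = *-identityˡ , *-identityʳ
      ; distrib = *-distribˡ , *-distribʳ }
    ; *-comm = *-comm } }

open CommutativeRing ℤ[z,q,q⁻¹] using (setoid)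
open CofactorIdeals ℤ[z,q,q⁻¹]

-- 1 - z^M in the ideal of two factors 1 - q^α z and 1 - q^β z

monomial : ℤ → ℕ → ℤ → Poly
monomial c a b = (c , a , b) ∷ []

z^_q^_ : ℕ → ℤ → Poly
z^ a q^ b = monomial (+ 1) a b

fac : ℤ → Poly
fac β = 1ₚ ++ -ₚ (z^ 1 q^ β)

module _ (α β : ℤ) where

  z^_q^_≡1 : ℕ → ℤ → Set
  z^ a q^ b ≡1 = 1ₚ ≡ z^ a q^ b mod⟨ fac α , fac β ⟩

  ≡1-cancel : ∀ {a b a′ b′} → z^ a q^ b ≡1 → z^ (a + a′) q^ (b ℤ.+ b′) ≡1 → z^ a′ q^ b′ ≡1
  ≡1-cancel {a} {b} {a′} {b′} t t′ = ≡mod-trans t′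
    (≡mod-trans (≡mod-* (≡mod-sym t) (≈⇒≡mod {x = z^ a′ q^ b′} ≋-refl))
                (≈⇒≡mod (≋-reflexive (cong (z^ a′ q^_) (ℤₚ.+-identityˡ b′)))))

  ≡1-*ℕ : ∀ {a b} → z^ a q^ b ≡1 → ∀ n → z^ (n ℕ.* a) q^ (+ n ℤ.* b) ≡1
  ≡1-*ℕ t zero            = ≈⇒≡mod ≋-refl
  ≡1-*ℕ {a} {b} t (suc n) = subst (z^ suc n ℕ.* a q^_≡1) (sym [1+n]b≡b+nb) (≡mod-* t (≡1-*ℕ t n))
    where
    [1+n]b≡b+nb : + suc n ℤ.* b ≡ b ℤ.+ + n ℤ.* b
    [1+n]b≡b+nb = trans (ℤₚ.*-distribʳ-+ b (+ 1) (+ n)) (cong (ℤ._+ + n ℤ.* b) (ℤₚ.*-identityˡ b))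

  q^≡1-*ℤ : ∀ {D} → z^ 0 q^ D ≡1 → ∀ t → z^ 0 q^ (t ℤ.* D) ≡1
  q^≡1-*ℤ {D} t (+ n)    = subst (z^_q^ (+ n ℤ.* D) ≡1) (ℕₚ.*-zeroʳ n) (≡1-*ℕ t n)
  q^≡1-*ℤ {D} t -[1+ n ] = ≡1-cancel (q^≡1-*ℤ t (+ suc n))
    (subst (z^ 0 q^_≡1) (sym (xD+[-x]D≡0 (+ suc n) D)) (≈⇒≡mod ≋-refl))
    where
    xD+[-x]D≡0 : ∀ x D → x ℤ.* D ℤ.+ ℤ.- x ℤ.* D ≡ + 0
    xD+[-x]D≡0 = solve-∀

  -- Modulo ⟨1 - q^α z, 1 - q^β z⟩ both z q^α and z q^β are 1, hence so are q^(β-α) and all of its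
  -- powers, and z^M = (z q^α)^M · q^(-t(β-α)).
  facZ∈⟨fac,fac⟩ : ∀ M t → t ℤ.* (β ℤ.- α) ≡ α ℤ.* + M → facZ M ∈⟨ fac α , fac β ⟩
  facZ∈⟨fac,fac⟩ M t t[β-α]≡αM = x-y∈⟨⟩ z^Mq^0≡1
    where
    zq^α≡1 : z^ 1 q^ α ≡1
    zq^α≡1 = difference ∈⟨⟩-gen₁
    zq^β≡1 : z^ 1 q^ (α ℤ.+ (β ℤ.- α)) ≡1
    zq^β≡1 = subst (z^ 1 q^_≡1) (sym (x+[y-x]≡y α β)) (difference ∈⟨⟩-gen₂)
      where
      x+[y-x]≡y : ∀ x y → x ℤ.+ (y ℤ.- x) ≡ y
      x+[y-x]≡y = solve-∀
    z^Mq^Mα≡1 : z^ M q^ (+ M ℤ.* α) ≡1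
    z^Mq^Mα≡1 = subst (z^_q^ (+ M ℤ.* α) ≡1) (ℕₚ.*-identityʳ M) (≡1-*ℕ zq^α≡1 M)
    exponent≡0 : ℤ.- t ℤ.* (β ℤ.- α) ℤ.+ + M ℤ.* α ≡ + 0
    exponent≡0 = begin
      ℤ.- t ℤ.* (β ℤ.- α) ℤ.+ + M ℤ.* α ≡⟨ rearrange t (β ℤ.- α) (+ M) α ⟩
      α ℤ.* + M ℤ.- t ℤ.* (β ℤ.- α)     ≡⟨ cong (λ x → α ℤ.* + M ℤ.- x) t[β-α]≡αM ⟩
      α ℤ.* + M ℤ.- α ℤ.* + M           ≡⟨ ℤₚ.+-inverseʳ (α ℤ.* + M) ⟩
      + 0                               ∎
      where
      open ≡-Reasoning
      rearrange : ∀ t d m a → ℤ.- t ℤ.* d ℤ.+ m ℤ.* a ≡ a ℤ.* m ℤ.- t ℤ.* d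
      rearrange = solve-∀
    z^Mq^0≡1 : z^ M q^ (+ 0) ≡1
    z^Mq^0≡1 = subst (z^ M q^_≡1) exponent≡0
      (≡mod-* (q^≡1-*ℤ (≡1-cancel zq^α≡1 zq^β≡1) (ℤ.- t)) z^Mq^Mα≡1)

facℤ : ℤ → Poly
facℤ e = fac (+ 2 ℤ.* e)

facZ∈⟨facℤ,facℤ⟩ : ∀ M t {u w} → t ℤ.* (w ℤ.- u) ≡ u ℤ.* + M → facZ M ∈⟨ facℤ u , facℤ w ⟩
facZ∈⟨facℤ,facℤ⟩ M t {u} {w} t[w-u]≡uM = facZ∈⟨fac,fac⟩ (+ 2 ℤ.* u) (+ 2 ℤ.* w) M t (begin
  t ℤ.* (+ 2 ℤ.* w ℤ.- + 2 ℤ.* u) ≡⟨ double-diff t w u ⟩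
  + 2 ℤ.* (t ℤ.* (w ℤ.- u))       ≡⟨ cong (+ 2 ℤ.*_) t[w-u]≡uM ⟩
  + 2 ℤ.* (u ℤ.* + M)             ≡⟨ ℤₚ.*-assoc (+ 2) u (+ M) ⟨
  + 2 ℤ.* u ℤ.* + M               ∎)
  where
  open ≡-Reasoning
  double-diff : ∀ t w u → t ℤ.* (+ 2 ℤ.* w ℤ.- + 2 ℤ.* u) ≡ + 2 ℤ.* (t ℤ.* (w ℤ.- u))
  double-diff = solve-∀

oneTo-∷ʳ : ∀ m → oneTo (suc m) ≡ oneTo m ∷ʳ suc m
oneTo-∷ʳ m = trans (cong (map suc) (sym (Listₚ.upTo-∷ʳ m))) (Listₚ.map-++ suc (upTo m) [ m ])

zProd-suc : ∀ m → zProd (suc m) ≋ zProd m *ₚ facZ (suc m)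
zProd-suc m = begin
  zProd (suc m)                              ≡⟨ cong (∏ ∘ map facZ) (oneTo-∷ʳ m) ⟩
  ∏ (map facZ (oneTo m ∷ʳ suc m))            ≡⟨ cong ∏ (Listₚ.map-++ facZ (oneTo m) [ suc m ]) ⟩
  ∏ (map facZ (oneTo m) ++ [ facZ (suc m) ]) ≈⟨ ∏-++ (map facZ (oneTo m)) [ facZ (suc m) ] ⟩
  zProd m *ₚ (facZ (suc m) *ₚ 1ₚ)            ≈⟨ *-congʳ (zProd m) (*-identityʳ (facZ (suc m))) ⟩
  zProd m *ₚ facZ (suc m)                    ∎
  where open SetoidReasoning setoid

InCofactorIdeal-zProd : ∀ {N f g fs} → InCofactorIdeal (f ∷ fs) (zProd (suc N)) →
  InCofactorIdeal (g ∷ fs) (zProd (suc N)) → facZ (suc (suc N)) ∈⟨ f , g ⟩ →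
  InCofactorIdeal (f ∷ g ∷ fs) (zProd (suc (suc N)))
InCofactorIdeal-zProd {N} mf mg facZ∈ =
  InCofactorIdeal-resp (≋-sym (zProd-suc (suc N))) (InCofactorIdeal-merge mf mg facZ∈)

-- Gapped intervals of exponents

interval : ℤ → ℕ → List ℤ
interval u zero    = []
interval u (suc n) = u ∷ interval (ℤ.suc u) n

-- u, u+1, …, u+A+B with u+A left out
gapped : ℤ → ℕ → ℕ → List ℤ
gapped u zero    B = interval (ℤ.suc u) B
gapped u (suc A) B = u ∷ gapped (ℤ.suc u) A B

suc-+ : ∀ u n → ℤ.suc u ℤ.+ + n ≡ u ℤ.+ + suc n
suc-+ u n = [1+u]+n≡u+[1+n] u (+ n)
  where
  [1+u]+n≡u+[1+n] : ∀ u n → (+ 1 ℤ.+ u) ℤ.+ n ≡ u ℤ.+ (+ 1 ℤ.+ n)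
  [1+u]+n≡u+[1+n] = solve-∀

interval-∷ʳ : ∀ u n → interval u (suc n) ≡ interval u n ∷ʳ (u ℤ.+ + n)
interval-∷ʳ u zero    = cong [_] (sym (ℤₚ.+-identityʳ u))
interval-∷ʳ u (suc n) = cong (u ∷_)
  (trans (interval-∷ʳ (ℤ.suc u) n) (cong (interval (ℤ.suc u) n ∷ʳ_) (suc-+ u n)))

gapped-∷ʳ : ∀ u A B → gapped u A (suc B) ≡ gapped u A B ∷ʳ (u ℤ.+ + suc (A + B))
gapped-∷ʳ u zero    B = trans (interval-∷ʳ (ℤ.suc u) B) (cong (interval (ℤ.suc u) B ∷ʳ_) (suc-+ u B))
gapped-∷ʳ u (suc A) B = cong (u ∷_) (trans (gapped-∷ʳ (ℤ.suc u) A B)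
  (cong (gapped (ℤ.suc u) A B ∷ʳ_) (suc-+ u (suc (A + B)))))

gapped-last : ∀ u A B → gapped u A (suc B) ↭ (u ℤ.+ + suc (A + B)) ∷ gapped u A B
gapped-last u A B = ↭-trans (↭-reflexive (gapped-∷ʳ u A B)) (↭-sym (∷↭∷ʳ _ (gapped u A B)))

gapped-no-tail : ∀ u A → gapped u A 0 ≡ interval u A
gapped-no-tail u zero    = refl
gapped-no-tail u (suc A) = cong (u ∷_) (gapped-no-tail (ℤ.suc u) A)

ZProdInCofactorIdeal : ℕ → Set
ZProdInCofactorIdeal N =
  ∀ u A B → A + B ≡ suc N → InCofactorIdeal (map facℤ (gapped u A B)) (zProd (suc N))

gapped-step-ends : ∀ {N} → ZProdInCofactorIdeal N → ∀ u A B → A + B ≡ N →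
  InCofactorIdeal (map facℤ (gapped u (suc A) (suc B))) (zProd (suc (suc N)))
gapped-step-ends ih u A B refl =
  InCofactorIdeal-↭ (map⁺ facℤ (↭-prep u (↭-sym (gapped-last (ℤ.suc u) A B))))
    (InCofactorIdeal-zProd
      (ih u (suc A) B refl)
      (InCofactorIdeal-↭ (map⁺ facℤ (gapped-last (ℤ.suc u) A B))
        (ih (ℤ.suc u) A (suc B) (ℕₚ.+-suc A B)))
      (facZ∈⟨facℤ,facℤ⟩ (suc (suc (A + B))) u (cong (u ℤ.*_) ([1+u]+x-u≡1+x u (+ suc (A + B))))))
  where
  [1+u]+x-u≡1+x : ∀ u x → (+ 1 ℤ.+ u) ℤ.+ x ℤ.- u ≡ + 1 ℤ.+ x
  [1+u]+x-u≡1+x = solve-∀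

gapped-step-front : ∀ {N} → ZProdInCofactorIdeal N → ∀ u A → A ≡ N →
  InCofactorIdeal (map facℤ (gapped u (suc (suc A)) 0)) (zProd (suc (suc N)))
gapped-step-front ih u A refl = InCofactorIdeal-zProd
  (subst (λ xs → InCofactorIdeal (map facℤ (u ∷ xs)) (zProd (suc A))) (sym (gapped-no-tail _ A))
    (ih u 1 A refl))
  (ih (ℤ.suc u) (suc A) 0 (ℕₚ.+-identityʳ (suc A)))
  (facZ∈⟨facℤ,facℤ⟩ (suc (suc A)) (u ℤ.* + suc (suc A)) (um[[1+u]-u]≡um u (+ suc (suc A))))
  where
  um[[1+u]-u]≡um : ∀ u m → u ℤ.* m ℤ.* ((+ 1 ℤ.+ u) ℤ.- u) ≡ u ℤ.* m
  um[[1+u]-u]≡um = solve-∀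

zProd∈gapped : ∀ N → ZProdInCofactorIdeal N
zProd∈gapped zero    u 1 0 refl = InCofactorIdeal-[ facℤ u ] (zProd 1)
zProd∈gapped zero    u 0 1 refl = InCofactorIdeal-[ facℤ (ℤ.suc u) ] (zProd 1)
zProd∈gapped (suc N) u (suc A) (suc B) A+B+2≡N+2 = gapped-step-ends (zProd∈gapped N) u A B
  (ℕₚ.suc-injective (trans (sym (ℕₚ.+-suc A B)) (ℕₚ.suc-injective A+B+2≡N+2)))
zProd∈gapped (suc N) u (suc (suc A)) 0 A+2≡N+2 = gapped-step-front (zProd∈gapped N) u A
  (trans (sym (ℕₚ.+-identityʳ A)) (ℕₚ.suc-injective (ℕₚ.suc-injective A+2≡N+2)))
zProd∈gapped (suc N) u 0 (suc (suc B)) refl =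
  subst (λ xs → InCofactorIdeal (map facℤ xs) (zProd (suc (suc B))))
    (gapped-no-tail (ℤ.suc u) (suc (suc B))) (gapped-step-front (zProd∈gapped B) (ℤ.suc u) B refl)
zProd∈gapped zero    u 0             0             ()
zProd∈gapped zero    u 1             (suc _)       ()
zProd∈gapped zero    u 0             (suc (suc _)) ()
zProd∈gapped zero    u (suc (suc _)) _             ()
zProd∈gapped (suc N) u 0             0             ()
zProd∈gapped (suc N) u 1             0             ()
zProd∈gapped (suc N) u 0             1             ()

-- Non-zero coefficients

monomial-+ : ∀ c c′ a b → monomial c a b ++ monomial c′ a b ≋ monomial (c ℤ.+ c′) a b
monomial-+ c c′ a b = coeffwise λ x y → go (⌊ a ℕ.≟ x ⌋ ∧ ⌊ b ℤ.≟ y ⌋)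
  where
  go : ∀ t → (if t then c else + 0) ℤ.+ ((if t then c′ else + 0) ℤ.+ + 0)
             ≡ (if t then c ℤ.+ c′ else + 0) ℤ.+ + 0
  go true  = trans (cong (λ x → c ℤ.+ x) (ℤₚ.+-identityʳ c′)) (sym (ℤₚ.+-identityʳ (c ℤ.+ c′)))
  go false = refl

monomial-0 : ∀ a b → monomial (+ 0) a b ≋ []
monomial-0 a b = coeffwise λ x y → go (⌊ a ℕ.≟ x ⌋ ∧ ⌊ b ℤ.≟ y ⌋)
  where
  go : ∀ t → (if t then + 0 else + 0) ℤ.+ + 0 ≡ + 0
  go true  = refl
  go false = refl

∑-monomial : ∀ {A : Set} (xs : List A) a b →
  ∑ (map (λ _ → monomial (+ 1) a b) xs) ≋ monomial (+ length xs) a b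
∑-monomial []       a b = ≋-sym (monomial-0 a b)
∑-monomial (x ∷ xs) a b =
  ≋-trans (+-cong ≋-refl (∑-monomial xs a b)) (monomial-+ (+ 1) (+ length xs) a b)

zdeg : Poly → ℕ
zdeg []                = 0
zdeg ((_ , a , _) ∷ p) = a ℕ.⊔ zdeg p

coeff-above-zdeg : ∀ p {a} b → zdeg p < a → coeff p a b ≡ + 0
coeff-above-zdeg []                  b _ = refl
coeff-above-zdeg ((c , a′ , b′) ∷ p) {a} b zdeg<a with a′ ℕ.≟ a
... | yes refl = ⊥-elim (ℕₚ.<-irrefl refl (ℕₚ.≤-<-trans (ℕₚ.m≤m⊔n a′ (zdeg p)) zdeg<a))
... | no _     =
  trans (ℤₚ.+-identityˡ _) (coeff-above-zdeg p b (ℕₚ.≤-<-trans (ℕₚ.m≤n⊔m a′ (zdeg p)) zdeg<a))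

coeff-fac : ∀ β → coeff (fac β) 1 β ≡ ℤ.- + 1
coeff-fac β with β ℤ.≟ β
... | yes _  = refl
... | no β≢β = ⊥-elim (β≢β refl)

-- The coefficient of z^(K+1) q^β in c z^K (1 - q^β z) is -c, and p has no such term.
++-monomial*fac-nonzero : ∀ p c K β → c ≢ + 0 → zdeg p ℕ.≤ K →
  NonZeroPoly (p ++ monomial c K (+ 0) *ₚ fac β)
++-monomial*fac-nonzero p c K β c≢0 zdeg≤K all-zero =
  c≢0 (ℤₚ.neg-injective (trans (sym (ℤₚ.-1*i≡-i c)) (trans (ℤₚ.*-comm (ℤ.- + 1) c) c*-1≡0)))
  where
  a : ℕ
  a = K + 1
  b : ℤ
  b = + 0 ℤ.+ β
  Y : Poly
  Y = map (mulMono (c , K , + 0)) (fac β)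
  zdeg<a : zdeg p < a
  zdeg<a = ℕₚ.≤-<-trans zdeg≤K (ℕₚ.m<m+n K ℕ.z<s)
  c*-1≡0 : c ℤ.* ℤ.- + 1 ≡ + 0
  c*-1≡0 = begin
    c ℤ.* ℤ.- + 1                        ≡⟨ cong (c ℤ.*_) (coeff-fac β) ⟨
    c ℤ.* coeff (fac β) 1 β              ≡⟨ coeff-shift c K (+ 0) (fac β) 1 β ⟨
    coeff Y a b                          ≡⟨ ℤₚ.+-identityʳ _ ⟨
    coeff Y a b ℤ.+ coeff [] a b         ≡⟨ coeff-++ Y [] a b ⟨
    coeff (Y ++ []) a b                  ≡⟨ ℤₚ.+-identityˡ _ ⟨
    + 0 ℤ.+ coeff (Y ++ []) a b
      ≡⟨ cong (ℤ._+ coeff (Y ++ []) a b) (coeff-above-zdeg p b zdeg<a) ⟨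
    coeff p a b ℤ.+ coeff (Y ++ []) a b  ≡⟨ coeff-++ p (Y ++ []) a b ⟨
    coeff (p ++ Y ++ []) a b             ≡⟨ all-zero a b ⟩
    + 0                                  ∎
    where open ≡-Reasoning

open CofactorSums ℤ._≟_ facℤ

-- Shift every coefficient a k by w k · z^K (1 - q^{2k} z), where K bounds all z-degrees and the
-- weights w k are non-zero with sum 0.
nonzero-adjust : ∀ a {ks} → Unique ks → 1 < length ks →
  ∃ λ a′ → All (NonZeroPoly ∘ a′) ks × cofactorSum a′ ks ≋ cofactorSum a ks
nonzero-adjust a {[]}           _ ()
nonzero-adjust a {_ ∷ []}       _ (ℕ.s≤s ())
nonzero-adjust a {k₀ ∷ k₁ ∷ ks} uniq@(k₀∉ ∷ _) _ =
  a′ , All.map (λ {k} → ++-monomial*fac-nonzero (a k) (w k) K (+ 2 ℤ.* k) (w≢0 k)) zdeg≤K ,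
  cofactorSum-shift a s uniq ∑s≋0
  where
  K : ℕ
  K = max 0 (map (zdeg ∘ a) (k₀ ∷ k₁ ∷ ks))
  zdeg≤K : All (λ k → zdeg (a k) ℕ.≤ K) (k₀ ∷ k₁ ∷ ks)
  zdeg≤K = Allₚ.map⁻ (xs≤max 0 (map (zdeg ∘ a) (k₀ ∷ k₁ ∷ ks)))
  w : ℤ → ℤ
  w k = if does (k ℤ.≟ k₀) then -[1+ length ks ] else + 1
  w≢0 : ∀ k → w k ≢ + 0
  w≢0 k with does (k ℤ.≟ k₀)
  ... | true  = λ ()
  ... | false = λ ()
  s : ℤ → Poly
  s k = monomial (w k) K (+ 0)
  a′ : ℤ → Poly
  a′ k = a k ++ s k *ₚ facℤ k
  s≋ : ∀ {k t} → does (k ℤ.≟ k₀) ≡ t → s k ≋ monomial (if t then -[1+ length ks ] else + 1) K (+ 0)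
  s≋ eq = ≋-reflexive (cong (λ t → monomial (if t then -[1+ length ks ] else + 1) K (+ 0)) eq)
  ∑s≋0 : ∑ (map s (k₀ ∷ k₁ ∷ ks)) ≋ []
  ∑s≋0 = begin
    s k₀ ++ ∑ (map s (k₁ ∷ ks))
      ≈⟨ +-cong (s≋ {k₀} (dec-true (k₀ ℤ.≟ k₀) refl))
                (∑-cong {u = s} {v = λ _ → monomial (+ 1) K (+ 0)}
                  (All.map (λ {k} k₀≢k → s≋ {k} (dec-false (k ℤ.≟ k₀) (≢-sym k₀≢k))) k₀∉)) ⟩
    monomial -[1+ length ks ] K (+ 0) ++ ∑ (map (λ _ → monomial (+ 1) K (+ 0)) (k₁ ∷ ks))
      ≈⟨ +-cong (≋-refl {monomial -[1+ length ks ] K (+ 0)}) (∑-monomial (k₁ ∷ ks) K (+ 0)) ⟩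
    monomial -[1+ length ks ] K (+ 0) ++ monomial (+ suc (length ks)) K (+ 0)
      ≈⟨ monomial-+ -[1+ length ks ] (+ suc (length ks)) K (+ 0) ⟩
    monomial (-[1+ length ks ] ℤ.+ + suc (length ks)) K (+ 0)
      ≡⟨ cong (λ c → monomial c K (+ 0)) (ℤₚ.+-inverseˡ (+ suc (length ks))) ⟩
    monomial (+ 0) K (+ 0)
      ≈⟨ monomial-0 K (+ 0) ⟩
    [] ∎
    where open SetoidReasoning setoid

-- The exponents of d′_{n,k}

exponents : ℕ → ℕ → List ℤ
exponents n k = map (λ j → + j) (oneTo n) ++ map (λ j → ℤ.- + j) (oneTo k)

interval-1 : ∀ n → interval (+ 1) n ≡ map (λ j → + j) (oneTo n)
interval-1 zero    = refl
interval-1 (suc n) = begin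
  interval (+ 1) (suc n)                    ≡⟨ interval-∷ʳ (+ 1) n ⟩
  interval (+ 1) n ∷ʳ + suc n               ≡⟨ cong (_∷ʳ + suc n) (interval-1 n) ⟩
  map (λ j → + j) (oneTo n) ∷ʳ + suc n      ≡⟨ Listₚ.map-++ (λ j → + j) (oneTo n) [ suc n ] ⟨
  map (λ j → + j) (oneTo n ∷ʳ suc n)        ≡⟨ cong (map (λ j → + j)) (oneTo-∷ʳ n) ⟨
  map (λ j → + j) (oneTo (suc n))           ∎
  where open ≡-Reasoning

gapped↭exponents : ∀ n k → gapped (ℤ.- + k) k n ↭ exponents n k
gapped↭exponents n zero    = ↭-reflexive (trans (interval-1 n) (sym (Listₚ.++-identityʳ _)))
gapped↭exponents n (suc k) = begin
  -[1+ k ] ∷ gapped (ℤ.suc -[1+ k ]) k n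
    ≡⟨ cong (λ u → -[1+ k ] ∷ gapped u k n) (1-[1+x]≡-x (+ k)) ⟩
  -[1+ k ] ∷ gapped (ℤ.- + k) k n         ↭⟨ ↭-prep -[1+ k ] (gapped↭exponents n k) ⟩
  -[1+ k ] ∷ exponents n k                ↭⟨ ∷↭∷ʳ -[1+ k ] (exponents n k) ⟩
  exponents n k ∷ʳ -[1+ k ]
    ≡⟨ Listₚ.++-assoc (map (λ j → + j) (oneTo n)) _ [ -[1+ k ] ] ⟩
  map (λ j → + j) (oneTo n) ++ (map (λ j → ℤ.- + j) (oneTo k) ∷ʳ -[1+ k ])
    ≡⟨ cong (map (λ j → + j) (oneTo n) ++_) (sym (trans (cong (map (λ j → ℤ.- + j)) (oneTo-∷ʳ k))
                                                         (Listₚ.map-++ (λ j → ℤ.- + j) (oneTo k) [ suc k ]))) ⟩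
  exponents n (suc k)                     ∎
  where
  open PermutationReasoning
  1-[1+x]≡-x : ∀ x → + 1 ℤ.+ ℤ.- (+ 1 ℤ.+ x) ≡ ℤ.- x
  1-[1+x]≡-x = solve-∀

oneTo-unique : ∀ n → Unique (oneTo n)
oneTo-unique n = Uniqueₚ.map⁺ ℕₚ.suc-injective (Uniqueₚ.upTo⁺ n)

exponents-unique : ∀ n k → Unique (exponents n k)
exponents-unique n k = Uniqueₚ.++⁺ (Uniqueₚ.map⁺ ℤₚ.+-injective (oneTo-unique n))
  (Uniqueₚ.map⁺ (ℤₚ.+-injective ∘ ℤₚ.neg-injective) (oneTo-unique k)) positive≢negative
  where
  positive≢negative : ∀ {e} →
    ¬ (e ∈ map (λ j → + j) (oneTo n) × e ∈ map (λ j → ℤ.- + j) (oneTo k))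
  positive≢negative (e∈pos , e∈neg) with ∈-map⁻ _ e∈pos | ∈-map⁻ _ e∈neg
  ... | _ , _ , refl | j , j∈oneTo , +i≡-j with ∈-map⁻ suc j∈oneTo
  ...   | _ , _ , refl = case +i≡-j of λ ()

exponents-length : ∀ n k → length (exponents n k) ≡ n + k
exponents-length n k = trans (Listₚ.length-++ (map (λ j → + j) (oneTo n)))
  (cong₂ _+_ (trans (Listₚ.length-map _ (oneTo n)) (oneTo-length n))
             (trans (Listₚ.length-map _ (oneTo k)) (oneTo-length k)))
  where
  oneTo-length : ∀ m → length (oneTo m) ≡ m
  oneTo-length m = trans (Listₚ.length-map suc (upTo m)) (Listₚ.length-upTo m)

suc∈oneTo : ∀ {n} (i : Fin n) → suc (toℕ i) ∈ oneTo n
suc∈oneTo i = ∈-map⁺ suc (∈-upTo⁺ (Finₚ.toℕ<n i))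

filter-≢-map : ∀ (g : ℕ → ℤ) → (∀ {x y} → g x ≡ g y → x ≡ y) → ∀ i xs →
  filter (λ e → ¬? (e ℤ.≟ g i)) (map g xs) ≡ map g (filter (λ j → T? (not ⌊ j ℕ.≟ i ⌋)) xs)
filter-≢-map g g-inj i []       = refl
filter-≢-map g g-inj i (x ∷ xs) with x ℕ.≟ i
... | yes refl = trans (Listₚ.filter-reject (λ e → ¬? (e ℤ.≟ g i)) (λ gi≢gi → gi≢gi refl))
                       (filter-≢-map g g-inj i xs)
... | no x≢i   = trans (Listₚ.filter-accept (λ e → ¬? (e ℤ.≟ g i)) (x≢i ∘ g-inj))
                       (cong (g x ∷_) (filter-≢-map g g-inj i xs))

map-facℤ-pos : ∀ xs → map facℤ (map (λ j → + j) xs) ≡ map facN xs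
map-facℤ-pos xs =
  trans (sym (Listₚ.map-∘ xs)) (Listₚ.map-cong (λ j → cong fac (sym (ℤₚ.pos-* 2 j))) xs)

map-facℤ-neg : ∀ xs → map facℤ (map (λ j → ℤ.- + j) xs) ≡ map facK xs
map-facℤ-neg xs = trans (sym (Listₚ.map-∘ xs)) (Listₚ.map-cong (λ j → cong fac
  (trans (sym (ℤₚ.neg-distribʳ-* (+ 2) (+ j))) (cong ℤ.-_ (sym (ℤₚ.pos-* 2 j))))) xs)

cofactor-exponents-facN : ∀ n k j → cofactor (exponents n k) (+ suc j) ≋ d'/facN n k (suc j)
cofactor-exponents-facN n k j = begin
  cofactor (exponents n k) (+ suc j)
    ≡⟨ cong (∏ ∘ map facℤ) (trans (Listₚ.filter-++ P? (map (λ j → + j) (oneTo n)) _)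
         (cong₂ _++_ (filter-≢-map (λ j → + j) ℤₚ.+-injective (suc j) (oneTo n))
                     (Listₚ.filter-all P? (Allₚ.map⁺ (Allₚ.map⁺ (All.universal (λ _ ()) (upTo k))))))) ⟩
  ∏ (map facℤ (map (λ j → + j) Nⱼ ++ map (λ j → ℤ.- + j) (oneTo k)))
    ≡⟨ cong ∏ (Listₚ.map-++ facℤ (map (λ j → + j) Nⱼ) _) ⟩
  ∏ (map facℤ (map (λ j → + j) Nⱼ) ++ map facℤ (map (λ j → ℤ.- + j) (oneTo k)))
    ≈⟨ ∏-++ (map facℤ (map (λ j → + j) Nⱼ)) _ ⟩
  ∏ (map facℤ (map (λ j → + j) Nⱼ)) *ₚ ∏ (map facℤ (map (λ j → ℤ.- + j) (oneTo k)))
    ≡⟨ cong₂ (λ xs ys → ∏ xs *ₚ ∏ ys) (map-facℤ-pos Nⱼ) (map-facℤ-neg (oneTo k)) ⟩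
  d'/facN n k (suc j) ∎
  where
  open SetoidReasoning setoid
  P? : (e : ℤ) → Dec (¬ e ≡ + suc j)
  P? e = ¬? (e ℤ.≟ + suc j)
  Nⱼ : List ℕ
  Nⱼ = filter (λ i → T? (not ⌊ i ℕ.≟ suc j ⌋)) (oneTo n)

cofactor-exponents-facK : ∀ n k j → cofactor (exponents n k) (ℤ.- + suc j) ≋ d'/facK n k (suc j)
cofactor-exponents-facK n k j = begin
  cofactor (exponents n k) (ℤ.- + suc j)
    ≡⟨ cong (∏ ∘ map facℤ) (trans (Listₚ.filter-++ P? (map (λ j → + j) (oneTo n)) _)
         (cong₂ _++_ (Listₚ.filter-all P? (Allₚ.map⁺ (Allₚ.map⁺ (All.universal (λ _ ()) (upTo n)))))
                     (filter-≢-map (λ j → ℤ.- + j) (ℤₚ.+-injective ∘ ℤₚ.neg-injective)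
                                   (suc j) (oneTo k)))) ⟩
  ∏ (map facℤ (map (λ j → + j) (oneTo n) ++ map (λ j → ℤ.- + j) Kⱼ))
    ≡⟨ cong ∏ (Listₚ.map-++ facℤ (map (λ j → + j) (oneTo n)) _) ⟩
  ∏ (map facℤ (map (λ j → + j) (oneTo n)) ++ map facℤ (map (λ j → ℤ.- + j) Kⱼ))
    ≈⟨ ∏-++ (map facℤ (map (λ j → + j) (oneTo n))) _ ⟩
  ∏ (map facℤ (map (λ j → + j) (oneTo n))) *ₚ ∏ (map facℤ (map (λ j → ℤ.- + j) Kⱼ))
    ≡⟨ cong₂ (λ xs ys → ∏ xs *ₚ ∏ ys) (map-facℤ-pos (oneTo n)) (map-facℤ-neg Kⱼ) ⟩
  d'/facK n k (suc j) ∎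
  where
  open SetoidReasoning setoid
  P? : (e : ℤ) → Dec (¬ e ≡ ℤ.- + suc j)
  P? e = ¬? (e ℤ.≟ ℤ.- + suc j)
  Kⱼ : List ℕ
  Kⱼ = filter (λ i → T? (not ⌊ i ℕ.≟ suc j ⌋)) (oneTo k)

tabulate-toℕ : ∀ {A : Set} n (h : ℕ → A) → tabulate {n = n} (h ∘ toℕ) ≡ applyUpTo h n
tabulate-toℕ zero    h = refl
tabulate-toℕ (suc n) h = cong (h 0 ∷_) (tabulate-toℕ n (h ∘ suc))

map-allFin : ∀ {A : Set} n (h : ℕ → A) → map (λ i → h (suc (toℕ i))) (allFin n) ≡ map h (oneTo n)
map-allFin n h = begin
  map (h ∘ suc ∘ toℕ) (allFin n) ≡⟨ Listₚ.map-tabulate id (h ∘ suc ∘ toℕ) ⟩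
  tabulate (h ∘ suc ∘ toℕ)       ≡⟨ tabulate-toℕ n (h ∘ suc) ⟩
  applyUpTo (h ∘ suc) n          ≡⟨ Listₚ.map-upTo (h ∘ suc) n ⟨
  map (h ∘ suc) (upTo n)         ≡⟨ Listₚ.map-∘ (upTo n) ⟩
  map h (oneTo n)                ∎
  where open ≡-Reasoning

cofactorSum-exponents : ∀ n k a → cofactorSum a (exponents n k) ≋
  sumₚ (map (λ i → a (+ suc (toℕ i)) *ₚ d'/facN n k (suc (toℕ i))) (allFin n))
    +ₚ sumₚ (map (λ i → a (ℤ.- + suc (toℕ i)) *ₚ d'/facK n k (suc (toℕ i))) (allFin k))
cofactorSum-exponents n k a = begin
  ∑ (map term (map (λ j → + j) (oneTo n) ++ map (λ j → ℤ.- + j) (oneTo k)))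
    ≡⟨ cong ∑ (Listₚ.map-++ term (map (λ j → + j) (oneTo n)) _) ⟩
  ∑ (map term (map (λ j → + j) (oneTo n)) ++ map term (map (λ j → ℤ.- + j) (oneTo k)))
    ≈⟨ ∑-++ (map term (map (λ j → + j) (oneTo n))) _ ⟩
  ∑ (map term (map (λ j → + j) (oneTo n))) ++ ∑ (map term (map (λ j → ℤ.- + j) (oneTo k)))
    ≡⟨ cong₂ (λ xs ys → ∑ xs ++ ∑ ys) (sym (Listₚ.map-∘ (oneTo n))) (sym (Listₚ.map-∘ (oneTo k))) ⟩
  ∑ (map (term ∘ λ j → + j) (oneTo n)) ++ ∑ (map (term ∘ λ j → ℤ.- + j) (oneTo k))
    ≈⟨ +-cong
         (∑-cong (Allₚ.map⁺ (All.universal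
           (λ j → *-congʳ (a (+ suc j)) (cofactor-exponents-facN n k j)) (upTo n))))
         (∑-cong (Allₚ.map⁺ (All.universal
           (λ j → *-congʳ (a (ℤ.- + suc j)) (cofactor-exponents-facK n k j)) (upTo k)))) ⟩
  ∑ (map (λ j → a (+ j) *ₚ d'/facN n k j) (oneTo n))
    ++ ∑ (map (λ j → a (ℤ.- + j) *ₚ d'/facK n k j) (oneTo k))
    ≡⟨ cong₂ (λ xs ys → ∑ xs ++ ∑ ys) (map-allFin n (λ j → a (+ j) *ₚ d'/facN n k j))
                                      (map-allFin k (λ j → a (ℤ.- + j) *ₚ d'/facK n k j)) ⟨
  sumₚ (map (λ i → a (+ suc (toℕ i)) *ₚ d'/facN n k (suc (toℕ i))) (allFin n))
    +ₚ sumₚ (map (λ i → a (ℤ.- + suc (toℕ i)) *ₚ d'/facK n k (suc (toℕ i))) (allFin k)) ∎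
  where
  open SetoidReasoning setoid
  term : ℤ → Poly
  term e = a e *ₚ cofactor (exponents n k) e

zProd∈exponents : ∀ n k N → n + k ≡ suc (suc N) →
  InCofactorIdeal (map facℤ (exponents n k)) (zProd (n + k))
zProd∈exponents n k N n+k≡N+2 = subst (InCofactorIdeal (map facℤ (exponents n k)) ∘ zProd) (sym n+k≡N+2)
  (InCofactorIdeal-↭ (map⁺ facℤ (gapped↭exponents n k))
    (zProd∈gapped (suc N) (ℤ.- + k) k n (trans (ℕₚ.+-comm k n) n+k≡N+2)))

cofactor-expansion-≥2 : ∀ n k N → n + k ≡ suc (suc N) →
  ∃ λ a → All (NonZeroPoly ∘ a) (exponents n k) × zProd (n + k) ≋ cofactorSum a (exponents n k)
cofactor-expansion-≥2 n k N n+k≡N+2 =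
  let a , zProd≋ = flatten (exponents-unique n k) (zProd∈exponents n k N n+k≡N+2)
      a′ , a′≢0 , a′≋a = nonzero-adjust a (exponents-unique n k)
        (subst (1 <_) (sym (trans (exponents-length n k) n+k≡N+2)) (ℕ.s≤s (ℕ.s≤s ℕ.z≤n)))
  in a′ , a′≢0 , ≋-trans zProd≋ (≋-sym a′≋a)

zProd-1-nonzero : NonZeroPoly (zProd 1)
zProd-1-nonzero all-zero = case all-zero 0 (+ 0) of λ ()

cofactor-expansion : ∀ n k → 0 < n + k →
  ∃ λ a → All (NonZeroPoly ∘ a) (exponents n k) × zProd (n + k) ≋ cofactorSum a (exponents n k)
cofactor-expansion 0             0             ()
cofactor-expansion 1             0             _ = (λ _ → zProd 1) , zProd-1-nonzero ∷ [] , ≋-refl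
cofactor-expansion 0             1             _ = (λ _ → zProd 1) , zProd-1-nonzero ∷ [] , ≋-refl
cofactor-expansion (suc (suc n)) k             _ = cofactor-expansion-≥2 (suc (suc n)) k (n + k) refl
cofactor-expansion 1             (suc k)       _ = cofactor-expansion-≥2 1 (suc k) k refl
cofactor-expansion 0             (suc (suc k)) _ = cofactor-expansion-≥2 0 (suc (suc k)) k refl

proposition4p6 : (n k : ℕ) → 0 < n + k →
    Σ (Fin n → Poly) λ p → Σ (Fin k → Poly) λ r →
      (∀ i → NonZeroPoly (p i)) × (∀ i → NonZeroPoly (r i)) ×
      (sumₚ (map (λ i → p i *ₚ d'/facN n k (suc (toℕ i))) (allFin n))
         +ₚ sumₚ (map (λ i → r i *ₚ d'/facK n k (suc (toℕ i))) (allFin k))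
         ≈ zProd (n + k))
proposition4p6 n k 0<n+k =
  let a , a≢0 , zProd≋ = cofactor-expansion n k 0<n+k
  in (λ i → a (+ suc (toℕ i))) , (λ i → a (ℤ.- + suc (toℕ i))) ,
     (λ i → All.lookup a≢0 (∈-++⁺ˡ (∈-map⁺ (λ j → + j) (suc∈oneTo i)))) ,
     (λ i → All.lookup a≢0 (∈-++⁺ʳ _ (∈-map⁺ (λ j → ℤ.- + j) (suc∈oneTo i)))) ,
     coeff-≡ (≋-trans (≋-sym (cofactorSum-exponents n k a)) (≋-sym zProd≋))
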